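{- Let $R_1,\ldots,R_n\subseteq\Omega$ satisfy $R_1\uplus\cdots\uplus R_n=\Omega$. Then for every formula $A$ of MRL, the sequent $\vdash R_1\{A\},\ldots,R_n\{A\}$ is derivable in MRL.
   Context: Fix a set $\Omega$ of roles (possibly infinite). A role set is a subset $R\subseteq\Omega$; $\overline{R}=\Omega\setminus R$; $R_1\uplus\cdots\uplus R_n=\Omega$ means the $R_i$ are pairwise disjoint with union $\Omega$. An ultrafilter on $\Omega$ is a family $\mathcal U$ of subsets of $\Omega$ with $\Omega\in\mathcal U$, closed upward and under binary intersection, and containing $R$ or $\overline R$ for every $R$. For an endomorphism $f:\Omega\to\Omega$, $f^{ -1}(R)=\{r\mid f(r)\in R\}$. Formulas of MRL, over first-order terms $t$ and variables $x$: $A,B::=a\mid\neg_f(A)\mid A\wedge_{\mathcal U}B\mid\forall_{\mathcal U}(\lambda x.A)$ ($a$ primitive formulas, $f$ endomorphisms of $\Omega$, $\mathcal U$ ultrafilters); $A[x:=t]$ is substitution. An i-formula is $R\{A\}$ with $R\subseteq\Omega$; a sequent $\Gamma$ is a finite multiset of i-formulas. Derivable sequents $\vdash\Gamma$ are generated by: (Id) $\vdash R_1\{a\},\ldots,R_n\{a\}$ whenever $R_1\uplus\cdots\uplus R_n=\Omega$; (Weaken) from $\Gamma$ infer $\Gamma,R\{A\}$; (Contract) from $\Gamma,R\{A\},R\{A\}$ infer $\Gamma,R\{A\}$; ($\neg$) from $\Gamma,f^{ -1}(R)\{A\}$ infer $\Gamma,R\{\neg_f(A)\}$; ($\wedge$-neg-l/r)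 if $R\notin\mathcal U$, from $\Gamma,R\{A\}$ (resp. $\Gamma,R\{B\}$) infer $\Gamma,R\{A\wedge_{\mathcal U}B\}$; ($\wedge$-pos) if $R\in\mathcal U$, from $\Gamma,R\{A\}$ and $\Gamma,R\{B\}$ infer $\Gamma,R\{A\wedge_{\mathcal U}B\}$; ($\forall$-neg) if $R\notin\mathcal U$, from $\Gamma,R\{A[x:=t]\}$ infer $\Gamma,R\{\forall_{\mathcal U}(\lambda x.A)\}$; ($\forall$-pos) if $R\in\mathcal U$ and $x$ not free in $\Gamma$, from $\Gamma,R\{A\}$ infer $\Gamma,R\{\forall_{\mathcal U}(\lambda x.A)\}$. -}

module Defs where

open import Data.Bool using (Bool; true; false; _∧_; _∨_; not; if_then_else_)
open import Data.Nat using (ℕ; suc; _⊔_; _≡ᵇ_)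
open import Data.Fin using (Fin)
open import Data.List using (List; []; _∷_; _++_; filterᵇ; foldr; concatMap; tabulate)
open import Data.List.Membership.Propositional using (_∈_)
open import Data.List.Relation.Binary.Permutation.Propositional using (_↭_)
open import Data.Sum using (_⊎_)
open import Data.Product using (_×_; ∃)
open import Relation.Binary.PropositionalEquality using (_≡_; _≢_)
open import Relation.Nullary using (¬_)
open import Data.Empty using (⊥)

RoleSet : Set → Set
RoleSet Ω = Ω → Bool

full : {Ω : Set} → RoleSet Ω
full _ = true

empty : {Ω : Set} → RoleSet Ω
empty _ = false

∁ : {Ω : Set} → RoleSet Ω → RoleSet Ω
∁ R ω = not (R ω)

_∩_ : {Ω : Set} → RoleSet Ω → RoleSet Ω → RoleSet Ω
(R ∩ S) ω = R ω ∧ S ω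

_⊆_ : {Ω : Set} → RoleSet Ω → RoleSet Ω → Set
R ⊆ S = ∀ ω → R ω ≡ true → S ω ≡ true

_⁻¹[_] : {Ω : Set} → (Ω → Ω) → RoleSet Ω → RoleSet Ω
(f ⁻¹[ R ]) ω = R (f ω)

IsPartition : {Ω : Set} {n : ℕ} → (Fin n → RoleSet Ω) → Set
IsPartition {Ω} {n} R =
  (∀ (i j : Fin n) → i ≢ j → ∀ ω → R i ω ≡ true → R j ω ≡ true → ⊥)
  × (∀ ω → ∃ λ (i : Fin n) → R i ω ≡ true)

record Ultrafilter (Ω : Set) : Set where
  field
    _∈𝒰         : RoleSet Ω → Bool
    full-∈      : full ∈𝒰 ≡ true
    empty-∉     : empty ∈𝒰 ≡ false
    upward      : ∀ R S → R ⊆ S → R ∈𝒰 ≡ true → S ∈𝒰 ≡ true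
    meet        : ∀ R S → R ∈𝒰 ≡ true → S ∈𝒰 ≡ true → (R ∩ S) ∈𝒰 ≡ true
    ultra       : ∀ R → R ∈𝒰 ≡ true ⊎ (∁ R) ∈𝒰 ≡ true

open Ultrafilter public

Var : Set
Var = ℕ

data Term (Fun : Set) : Set where
  var : Var → Term Fun
  fn  : Fun → List (Term Fun) → Term Fun

mutual
  fvT : {Fun : Set} → Term Fun → List Var
  fvT (var x)   = x ∷ []
  fvT (fn f ts) = fvTs ts

  fvTs : {Fun : Set} → List (Term Fun) → List Var
  fvTs []       = []
  fvTs (t ∷ ts) = fvT t ++ fvTs ts

Subst : Set → Set
Subst Fun = Var → Term Fun

mutual
  substT : {Fun : Set} → Subst Fun → Term Fun → Term Fun
  substT σ (var x)   = σ x
  substT σ (fn f ts) = fn f (substTs σ ts)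

  substTs : {Fun : Set} → Subst Fun → List (Term Fun) → List (Term Fun)
  substTs σ []       = []
  substTs σ (t ∷ ts) = substT σ t ∷ substTs σ ts

_[_↦_] : {Fun : Set} → Subst Fun → Var → Term Fun → Subst Fun
(σ [ x ↦ t ]) y = if y ≡ᵇ x then t else σ y

data Form (Fun Pred Ω : Set) : Set where
  atom : Pred → List (Term Fun) → Form Fun Pred Ω
  ¬[_]_ : (Ω → Ω) → Form Fun Pred Ω → Form Fun Pred Ω
  _∧[_]_ : Form Fun Pred Ω → Ultrafilter Ω → Form Fun Pred Ω → Form Fun Pred Ω
  ∀[_]λ_∙_ : Ultrafilter Ω → Var → Form Fun Pred Ω → Form Fun Pred Ω

elem : Var → List Var → Bool
elem x []       = false
elem x (y ∷ ys) = (x ≡ᵇ y) ∨ elem x ys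

fv : {Fun Pred Ω : Set} → Form Fun Pred Ω → List Var
fv (atom P ts)      = fvTs ts
fv (¬[ f ] A)       = fv A
fv (A ∧[ U ] B)     = fv A ++ fv B
fv (∀[ U ]λ x ∙ A)  = filterᵇ (λ y → not (y ≡ᵇ x)) (fv A)

maxList : List Var → Var
maxList = foldr _⊔_ 0

-- Capture-avoiding simultaneous substitution (Stoughton style): the bound
-- variable is kept unless it would capture, in which case it is renamed
-- to a fresh variable.
subst : {Fun Pred Ω : Set} → Subst Fun → Form Fun Pred Ω → Form Fun Pred Ω
subst σ (atom P ts)     = atom P (substTs σ ts)
subst σ (¬[ f ] A)      = ¬[ f ] subst σ A
subst σ (A ∧[ U ] B)    = subst σ A ∧[ U ] subst σ B
subst σ (∀[ U ]λ x ∙ A) =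
  let avoid = concatMap (λ z → fvT (σ z)) (fv (∀[ U ]λ x ∙ A))
      x'    = if elem x avoid then suc (maxList avoid) else x
  in ∀[ U ]λ x' ∙ subst (σ [ x ↦ var x' ]) A

_[_≔_] : {Fun Pred Ω : Set} → Form Fun Pred Ω → Var → Term Fun → Form Fun Pred Ω
A [ x ≔ t ] = subst (var [ x ↦ t ]) A

record IForm (Fun Pred Ω : Set) : Set where
  constructor _﹛_﹜
  field
    roles : RoleSet Ω
    form  : Form Fun Pred Ω

Sequent : Set → Set → Set → Set
Sequent Fun Pred Ω = List (IForm Fun Pred Ω)

fvSeq : {Fun Pred Ω : Set} → Sequent Fun Pred Ω → List Var
fvSeq = concatMap (λ φ → fv (IForm.form φ))

-- Derivability in MRL.  Γ , R{A} is written  R ﹛ A ﹜ ∷ Γ ; the exchange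
-- rule makes sequents multisets.

data ⊢_ {Fun Pred Ω : Set} : Sequent Fun Pred Ω → Set where
  exchange : ∀ {Γ Δ} → Γ ↭ Δ → ⊢ Γ → ⊢ Δ
  Id       : ∀ {n} (R : Fin n → RoleSet Ω) → IsPartition R →
             ∀ (P : Pred) (ts : List (Term Fun)) →
             ⊢ tabulate (λ i → R i ﹛ atom P ts ﹜)
  weaken   : ∀ {Γ R A} → ⊢ Γ → ⊢ (R ﹛ A ﹜ ∷ Γ)
  contract : ∀ {Γ R A} → ⊢ (R ﹛ A ﹜ ∷ R ﹛ A ﹜ ∷ Γ) → ⊢ (R ﹛ A ﹜ ∷ Γ)
  neg      : ∀ {Γ R A f} → ⊢ ((f ⁻¹[ R ]) ﹛ A ﹜ ∷ Γ) → ⊢ (R ﹛ ¬[ f ] A ﹜ ∷ Γ)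
  ∧-neg-l  : ∀ {Γ R A B U} → (U ∈𝒰) R ≡ false →
             ⊢ (R ﹛ A ﹜ ∷ Γ) → ⊢ (R ﹛ A ∧[ U ] B ﹜ ∷ Γ)
  ∧-neg-r  : ∀ {Γ R A B U} → (U ∈𝒰) R ≡ false →
             ⊢ (R ﹛ B ﹜ ∷ Γ) → ⊢ (R ﹛ A ∧[ U ] B ﹜ ∷ Γ)
  ∧-pos    : ∀ {Γ R A B U} → (U ∈𝒰) R ≡ true →
             ⊢ (R ﹛ A ﹜ ∷ Γ) → ⊢ (R ﹛ B ﹜ ∷ Γ) → ⊢ (R ﹛ A ∧[ U ] B ﹜ ∷ Γ)
  ∀-neg    : ∀ {Γ R A U x} (t : Term Fun) → (U ∈𝒰) R ≡ false →
             ⊢ (R ﹛ A [ x ≔ t ] ﹜ ∷ Γ) → ⊢ (R ﹛ ∀[ U ]λ x ∙ A ﹜ ∷ Γ)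
  ∀-pos    : ∀ {Γ R A U x} → (U ∈𝒰) R ≡ true → ¬ (x ∈ fvSeq Γ) →
             ⊢ (R ﹛ A ﹜ ∷ Γ) → ⊢ (R ﹛ ∀[ U ]λ x ∙ A ﹜ ∷ Γ)

{-# OPTIONS --safe #-}
-- Induction on A, for all partitions at once.  Atoms are axioms, and ¬_f
-- replaces the partition by its preimage under f, again a partition.  For ∧_𝒰
-- and ∀_𝒰 exactly one block R_i of a finite partition lies in the ultrafilter 𝒰
-- (if none did, their complements would, and so would their intersection, which
-- is empty).  Every other block is introduced by a one-premise negative rule,
-- and the positive rule is applied to R_i alone, the other blocks forming the
-- common context of its premises; for ∀_𝒰 the negative instance is t := x.
module Submission where

open import Defs
open import Data.Nat using (ℕ; zero; suc; _≡ᵇ_)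
open import Data.Nat.Properties using (≡ᵇ⇒≡; ≡⇒≡ᵇ)
open import Data.Bool using (true; false; not; T?)
open import Data.Bool.Properties using (¬-not; T-≡; T-not-≡) renaming (_≟_ to _≟ᵇ_)
open import Data.Fin as Fin using (Fin)
open import Data.Fin.Properties using (any?)
open import Data.List using (List; []; _∷_; _++_; map; tabulate; allFin; concatMap)
open import Data.List.Properties using (map-tabulate; concatMap-cong; concatMap-pure)
open import Data.List.Membership.Propositional using (_∈_; _∉_)
open import Data.List.Membership.Propositional.Properties
  using (∈-∃++; ∈-allFin; ∈-filter⁻; ∈-++⁻)
open import Data.List.Relation.Unary.Any using (here; there)
open import Data.List.Relation.Unary.Unique.Propositional.Properties
  using (allFin⁺; Unique[x∷xs]⇒x∉xs)
open import Data.List.Relation.Binary.Permutation.Propositional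
  using (_↭_; ↭-refl; ↭-sym; ↭-trans; ↭-reflexive; ↭⇒↭ₛ)
open import Data.List.Relation.Binary.Permutation.Propositional.Properties using (shift; map⁺)
import Data.List.Relation.Binary.Permutation.Setoid.Properties as SetoidPermutation
open import Data.Empty using (⊥; ⊥-elim)
open import Data.Sum using (inj₁; inj₂)
open import Data.Product using (∃; _×_; _,_; proj₁; proj₂)
open import Function using (_∘_; id; Equivalence)
open import Relation.Nullary using (yes; no)
open import Relation.Binary.PropositionalEquality
  using (_≡_; _≢_; _≗_; refl; sym; trans; cong; cong₂; setoid)
  renaming (subst to ≡-subst)

open Equivalence using (to; from)

private
  variable
    Fun Pred Ω X : Set
    n : ℕ

Rule : IForm Fun Pred Ω → IForm Fun Pred Ω → Set
Rule F G = ∀ {Γ} → ⊢ (F ∷ Γ) → ⊢ (G ∷ Γ)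

⊢-map-rule : ∀ {F G : X → IForm Fun Pred Ω} Γ xs →
             (∀ {x} → x ∈ xs → Rule (F x) (G x)) →
             ⊢ (Γ ++ map F xs) → ⊢ (Γ ++ map G xs)
⊢-map-rule Γ []       rule ⊢Γ = ⊢Γ
⊢-map-rule {F = F} {G} Γ (x ∷ xs) rule ⊢Γ =
  exchange (↭-sym (shift (G x) Γ _))
    (rule (here refl)
      (⊢-map-rule (F x ∷ Γ) xs (rule ∘ there) (exchange (shift (F x) Γ _) ⊢Γ)))

tabulate-↭ : ∀ (F : Fin n → X) {xs} → allFin n ↭ xs → tabulate F ↭ map F xs
tabulate-↭ F allFin↭ = ↭-trans (↭-reflexive (sym (map-tabulate id F))) (map⁺ F allFin↭)

⊢-tabulate-rule : ∀ {F G : Fin n → IForm Fun Pred Ω} →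
                  (∀ i → Rule (F i) (G i)) → ⊢ tabulate F → ⊢ tabulate G
⊢-tabulate-rule {n = n} {F = F} {G} rule ⊢F =
  exchange (↭-sym (tabulate-↭ G ↭-refl))
    (⊢-map-rule [] (allFin n) (λ {i} _ → rule i) (exchange (tabulate-↭ F ↭-refl) ⊢F))

allFin-focus : (i : Fin n) → ∃ λ Δ → allFin n ↭ i ∷ Δ × i ∉ Δ
allFin-focus {n} i with ys , zs , eq ← ∈-∃++ (∈-allFin i) =
  ys ++ zs , allFin↭ , Unique[x∷xs]⇒x∉xs (Unique-resp-↭ (↭⇒↭ₛ allFin↭) (allFin⁺ n))
  where
  open SetoidPermutation (setoid (Fin n)) using (Unique-resp-↭)
  allFin↭ : allFin n ↭ i ∷ ys ++ zs
  allFin↭ = ≡-subst (_↭ i ∷ ys ++ zs) (sym eq) (shift i ys zs)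

module _ {i : Fin n} {Δ : List (Fin n)} (allFin↭ : allFin n ↭ i ∷ Δ) where

  ⊢-focus : ∀ {F G : Fin n → IForm Fun Pred Ω} →
            (∀ {j} → j ∈ Δ → Rule (F j) (G j)) → ⊢ tabulate F → ⊢ (F i ∷ map G Δ)
  ⊢-focus {F = F} rule ⊢F = ⊢-map-rule (F i ∷ []) Δ rule (exchange (tabulate-↭ F allFin↭) ⊢F)

  ⊢-unfocus : ∀ {G : Fin n → IForm Fun Pred Ω} → ⊢ (G i ∷ map G Δ) → ⊢ tabulate G
  ⊢-unfocus {G = G} = exchange (↭-sym (tabulate-↭ G allFin↭))

preimage-isPartition : ∀ {R : Fin n → RoleSet Ω} (f : Ω → Ω) →
                       IsPartition R → IsPartition (λ i → f ⁻¹[ R i ])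
preimage-isPartition f (disjoint , cover) =
  (λ i j i≢j ω → disjoint i j i≢j (f ω)) , cover ∘ f

⋂ : (Fin n → RoleSet Ω) → RoleSet Ω
⋂ {zero}  S = full
⋂ {suc n} S = S Fin.zero ∩ ⋂ (S ∘ Fin.suc)

⋂-⊆ : (S : Fin n → RoleSet Ω) (i : Fin n) → ⋂ S ⊆ S i
⋂-⊆ S Fin.zero    ω ⋂Sω with S Fin.zero ω
... | true = refl
⋂-⊆ S (Fin.suc i) ω ⋂Sω with S Fin.zero ω
... | true = ⋂-⊆ (S ∘ Fin.suc) i ω ⋂Sω

module _ (U : Ultrafilter Ω) where

  ⋂-∈𝒰 : (S : Fin n → RoleSet Ω) → (∀ i → (U ∈𝒰) (S i) ≡ true) → (U ∈𝒰) (⋂ S) ≡ true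
  ⋂-∈𝒰 {zero}  S S∈𝒰 = full-∈ U
  ⋂-∈𝒰 {suc n} S S∈𝒰 = meet U _ _ (S∈𝒰 Fin.zero) (⋂-∈𝒰 (S ∘ Fin.suc) (S∈𝒰 ∘ Fin.suc))

  ⊆empty-∉𝒰 : (S : RoleSet Ω) → S ⊆ empty → (U ∈𝒰) S ≢ true
  ⊆empty-∉𝒰 S S⊆∅ S∈𝒰 with () ← trans (sym (upward U S empty S⊆∅ S∈𝒰)) (empty-∉ U)

  module _ {R : Fin n → RoleSet Ω} (partition : IsPartition R) where

    partition-block-∈𝒰 : ∃ λ i → (U ∈𝒰) (R i) ≡ true
    partition-block-∈𝒰 with any? (λ i → (U ∈𝒰) (R i) ≟ᵇ true)
    ... | yes block = block
    ... | no  none  = ⊥-elim (⊆empty-∉𝒰 (⋂ (∁ ∘ R)) ⋂∁R⊆∅ (⋂-∈𝒰 (∁ ∘ R) ∁R∈𝒰))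
      where
      ∁R∈𝒰 : ∀ i → (U ∈𝒰) (∁ (R i)) ≡ true
      ∁R∈𝒰 i with ultra U (R i)
      ... | inj₁ Ri∈𝒰  = ⊥-elim (none (i , Ri∈𝒰))
      ... | inj₂ ∁Ri∈𝒰 = ∁Ri∈𝒰
      ⋂∁R⊆∅ : ⋂ (∁ ∘ R) ⊆ empty
      ⋂∁R⊆∅ ω ⋂∁Rω with i , Riω ← proj₂ partition ω =
        ≡-subst (λ b → not b ≡ true) Riω (⋂-⊆ (∁ ∘ R) i ω ⋂∁Rω)

    partition-block-∈𝒰-unique : ∀ {i j} → i ≢ j →
                                (U ∈𝒰) (R i) ≡ true → (U ∈𝒰) (R j) ≡ true → ⊥
    partition-block-∈𝒰-unique {i} {j} i≢j Ri∈𝒰 Rj∈𝒰 =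
      ⊆empty-∉𝒰 (R i ∩ R j) Ri∩Rj⊆∅ (meet U _ _ Ri∈𝒰 Rj∈𝒰)
      where
      Ri∩Rj⊆∅ : (R i ∩ R j) ⊆ empty
      Ri∩Rj⊆∅ ω _ with true ← R i ω in Riω | true ← R j ω in Rjω
        = ⊥-elim (proj₁ partition i j i≢j ω Riω Rjω)

    record PositiveBlock : Set where
      field
        block    : Fin n
        others   : List (Fin n)
        allFin↭  : allFin n ↭ block ∷ others
        block-∈  : (U ∈𝒰) (R block) ≡ true
        others-∉ : ∀ {j} → j ∈ others → (U ∈𝒰) (R j) ≡ false

    positiveBlock : PositiveBlock
    positiveBlock =
      let i , Ri∈𝒰 = partition-block-∈𝒰
          Δ , allFin↭ , i∉Δ = allFin-focus i
      in record
        { block = i ; others = Δ ; allFin↭ = allFin↭ ; block-∈ = Ri∈𝒰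
        ; others-∉ = λ j∈Δ → ¬-not λ Rj∈𝒰 →
            partition-block-∈𝒰-unique (λ { refl → i∉Δ j∈Δ }) Ri∈𝒰 Rj∈𝒰
        }

bound-∉-fv : (U : Ultrafilter Ω) (x : Var) (A : Form Fun Pred Ω) → x ∉ fv (∀[ U ]λ x ∙ A)
bound-∉-fv U x A x∈ with _ , x≢x ← ∈-filter⁻ (λ y → T? (not (y ≡ᵇ x))) {xs = fv A} x∈
  with () ← trans (sym (to T-≡ (≡⇒≡ᵇ x x refl))) (to T-not-≡ x≢x)

∉⇒elem≡false : ∀ {y} ys → y ∉ ys → elem y ys ≡ false
∉⇒elem≡false []       y∉ = refl
∉⇒elem≡false {y} (w ∷ ws) y∉ with y ≡ᵇ w in y≡ᵇw
... | true  = ⊥-elim (y∉ (here (≡ᵇ⇒≡ y w (from T-≡ y≡ᵇw))))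
... | false = ∉⇒elem≡false ws (y∉ ∘ there)

[↦var]-identity : ∀ {σ : Subst Fun} → σ ≗ var → ∀ y → (σ [ y ↦ var y ]) ≗ var
[↦var]-identity σ≗var y z with z ≡ᵇ y in z≡ᵇy
... | true  = cong var (sym (≡ᵇ⇒≡ z y (from T-≡ z≡ᵇy)))
... | false = σ≗var z

mutual
  substT-identity : ∀ {σ : Subst Fun} → σ ≗ var → ∀ t → substT σ t ≡ t
  substT-identity σ≗var (var x)   = σ≗var x
  substT-identity σ≗var (fn f ts) = cong (fn f) (substTs-identity σ≗var ts)

  substTs-identity : ∀ {σ : Subst Fun} → σ ≗ var → ∀ ts → substTs σ ts ≡ ts
  substTs-identity σ≗var []       = refl
  substTs-identity σ≗var (t ∷ ts) = cong₂ _∷_ (substT-identity σ≗var t) (substTs-identity σ≗var ts)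

-- A binder is renamed only if it occurs free in the image of σ, which for
-- σ ≗ var means free in the quantified formula itself: never.
subst-identity : ∀ {σ : Subst Fun} → σ ≗ var → (A : Form Fun Pred Ω) → subst σ A ≡ A
subst-identity σ≗var (atom P ts)  = cong (atom P) (substTs-identity σ≗var ts)
subst-identity σ≗var (¬[ f ] A)   = cong (¬[ f ]_) (subst-identity σ≗var A)
subst-identity σ≗var (A ∧[ U ] B) = cong₂ (_∧[ U ]_) (subst-identity σ≗var A) (subst-identity σ≗var B)
subst-identity σ≗var (∀[ U ]λ y ∙ A)
  rewrite concatMap-cong (cong fvT ∘ σ≗var) (fv (∀[ U ]λ y ∙ A))
        | concatMap-pure (fv (∀[ U ]λ y ∙ A))
        | ∉⇒elem≡false (fv (∀[ U ]λ y ∙ A)) (bound-∉-fv U y A)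
  = cong (∀[ U ]λ y ∙_) (subst-identity ([↦var]-identity σ≗var y) A)

[≔var]-identity : (A : Form Fun Pred Ω) (x : Var) → A [ x ≔ var x ] ≡ A
[≔var]-identity A x = subst-identity ([↦var]-identity (λ _ → refl) x) A

bound-∉-fvSeq : ∀ (R : X → RoleSet Ω) (U : Ultrafilter Ω) x (A : Form Fun Pred Ω) xs →
                x ∉ fvSeq (map (λ j → R j ﹛ ∀[ U ]λ x ∙ A ﹜) xs)
bound-∉-fvSeq R U x A []       ()
bound-∉-fvSeq R U x A (j ∷ xs) x∈ with ∈-++⁻ (fv (∀[ U ]λ x ∙ A)) x∈
... | inj₁ x∈fv = bound-∉-fv U x A x∈fv
... | inj₂ x∈Γ  = bound-∉-fvSeq R U x A xs x∈Γ

module _ {R : Fin n → RoleSet Ω} (partition : IsPartition R) where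

  ⊢-¬ : ∀ {f : Ω → Ω} {A : Form Fun Pred Ω} →
        ⊢ tabulate (λ i → (f ⁻¹[ R i ]) ﹛ A ﹜) → ⊢ tabulate (λ i → R i ﹛ ¬[ f ] A ﹜)
  ⊢-¬ = ⊢-tabulate-rule (λ _ → neg)

  ⊢-∧ : ∀ {U} {A B : Form Fun Pred Ω} →
        ⊢ tabulate (λ i → R i ﹛ A ﹜) → ⊢ tabulate (λ i → R i ﹛ B ﹜) →
        ⊢ tabulate (λ i → R i ﹛ A ∧[ U ] B ﹜)
  ⊢-∧ {U = U} ⊢A ⊢B =
    ⊢-unfocus allFin↭
      (∧-pos block-∈ (⊢-focus allFin↭ (λ j∈ → ∧-neg-l (others-∉ j∈)) ⊢A)
                     (⊢-focus allFin↭ (λ j∈ → ∧-neg-r (others-∉ j∈)) ⊢B))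
    where open PositiveBlock (positiveBlock U partition)

  ⊢-∀ : ∀ {U x} {A : Form Fun Pred Ω} →
        ⊢ tabulate (λ i → R i ﹛ A ﹜) → ⊢ tabulate (λ i → R i ﹛ ∀[ U ]λ x ∙ A ﹜)
  ⊢-∀ {U = U} {x} {A} ⊢A =
    ⊢-unfocus allFin↭
      (∀-pos block-∈ (bound-∉-fvSeq R U x A others)
        (⊢-focus allFin↭ (λ j∈ → ∀-neg-var (others-∉ j∈)) ⊢A))
    where
    open PositiveBlock (positiveBlock U partition)
    ∀-neg-var : ∀ {S} → (U ∈𝒰) S ≡ false → Rule (S ﹛ A ﹜) (S ﹛ ∀[ U ]λ x ∙ A ﹜)
    ∀-neg-var {S} S∉𝒰 {Γ} ⊢A =
      ∀-neg (var x) S∉𝒰 (≡-subst (λ C → ⊢ (S ﹛ C ﹜ ∷ Γ)) (sym ([≔var]-identity A x)) ⊢A)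

lemma4 : {Fun Pred Ω : Set} (n : ℕ) (R : Fin n → RoleSet Ω) → IsPartition R →
    (A : Form Fun Pred Ω) → ⊢ tabulate (λ i → R i ﹛ A ﹜)
lemma4 n R partition (atom P ts)      = Id R partition P ts
lemma4 n R partition (¬[ f ] A)       =
  ⊢-¬ partition (lemma4 n (λ i → f ⁻¹[ R i ]) (preimage-isPartition f partition) A)
lemma4 n R partition (A ∧[ U ] B)     = ⊢-∧ partition (lemma4 n R partition A) (lemma4 n R partition B)
lemma4 n R partition (∀[ U ]λ x ∙ A)  = ⊢-∀ partition (lemma4 n R partition A)
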